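{- Let $M=(ST,AC,\{av_A\}_{A\subseteq AG},\{out_A\}_{A\subseteq AG},lab)$ be an abstract multi-agent action model. The following two sets of conditions are equivalent. (1) (a) for every $A\subseteq AG$ and $s\in ST$, $av_A(s)=av_{AG}(s)|_A$; (b) for every $s\in ST$, $av_{AG}(s)=\{\sigma_{AG}\in JA_{AG}:out_{AG}(s,\sigma_{AG})\neq\emptyset\}$; (c) for every $A\subseteq AG$, $s\in ST$ and $\sigma_A\in JA_A$, $out_A(s,\sigma_A)=\bigcup\{out_{AG}(s,\sigma_{AG}):\sigma_{AG}\in JA_{AG},\ \sigma_A\subseteq\sigma_{AG}\}$. (2) (a) for every $A\subseteq AG$, $s\in ST$ and $\sigma_A\in JA_A$, $out_A(s,\sigma_A)=\bigcup\{out_{AG}(s,\sigma_{AG}):\sigma_{AG}\in JA_{AG},\ \sigma_A\subseteq\sigma_{AG}\}$; (b) for every $A\subseteq AG$ and $s\in ST$, $av_A(s)=\{\sigma_A\in JA_A:out_A(s,\sigma_A)\neq\emptyset\}$.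
   Context: Fix a nonempty finite set $AG$ of agents and a countable set $AP$ of atomic propositions; a coalition is any $A\subseteq AG$. Given a nonempty set $AC$ of actions, a joint action of $A$ is a function $\sigma_A:A\to AC$; $JA_A$ is the set of them ($JA_\emptyset=\{\emptyset\}$); joint actions are sets of ordered pairs, so inclusion $\sigma_A\subseteq\sigma_{AG}$ makes sense; for a set $\Sigma$ of joint actions of $AG$, $\Sigma|_A=\{\sigma|_A:\sigma\in\Sigma\}$ where $\sigma|_A$ is restriction. An abstract multi-agent action model is $M=(ST,AC,\{av_A\},\{out_A\},lab)$ with $ST$ a nonempty set of states, $AC$ a nonempty set of actions, $av_A:ST\to\mathcal P(JA_A)$, $out_A:ST\times JA_A\to\mathcal P(ST)$, $lab:ST\to\mathcal P(AP)$. -}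

module Defs where

open import Data.Nat using (ℕ; zero; suc)
open import Data.Bool using (true; false)
open import Data.Fin using (Fin; zero; suc)
open import Data.Fin.Subset using (Subset) renaming (⊤ to Full)
open import Data.Vec using ([]; _∷_)
open import Data.Unit using () renaming (⊤ to Unit)
open import Data.Empty using (⊥)
open import Data.Product using (_×_; _,_; Σ; ∃)
open import Relation.Binary.PropositionalEquality using (_≡_)
open import Relation.Nullary using (¬_)
open import Function using (Injective; _⇔_)

-- Agents: AG = Fin n (nonempty is imposed in the theorem via n = suc m).
-- Coalitions: A : Subset n (bit vector).  The grand coalition AG is Full.

-- Joint actions of a coalition A: functions A → AC, represented canonically
-- as a tuple with one AC-component per agent in A (JA AC [] = {∅}).
JA : Set → ∀ {n} → Subset n → Set
JA AC []          = Unit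
JA AC (true ∷ A)  = AC × JA AC A
JA AC (false ∷ A) = JA AC A

-- Graph of a joint action: Maps σ i a  iff  (i , a) ∈ σ  (as a set of pairs).
Maps : ∀ {AC n} {A : Subset n} → JA AC A → Fin n → AC → Set
Maps {A = true ∷ A}  (a , σ) zero    b = a ≡ b
Maps {A = true ∷ A}  (a , σ) (suc i) b = Maps {A = A} σ i b
Maps {A = false ∷ A} σ       zero    b = ⊥
Maps {A = false ∷ A} σ       (suc i) b = Maps {A = A} σ i b

_⊆J_ : ∀ {AC n} {A B : Subset n} → JA AC A → JA AC B → Set
_⊆J_ {AC} {n} {A} {B} σ τ = ∀ (i : Fin n) (a : AC) → Maps {A = A} σ i a → Maps {A = B} τ i a

restrict : ∀ {AC n} (A : Subset n) → JA AC (Full {n}) → JA AC A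
restrict []          _       = _
restrict (true ∷ A)  (a , σ) = a , restrict A σ
restrict (false ∷ A) (a , σ) = restrict A σ

-- Abstract multi-agent action model over agents Fin n and propositions AP.
-- Subsets of X are predicates X → Set.
record Model (n : ℕ) (AP : Set) : Set₁ where
  field
    ST   : Set
    AC   : Set
    st₀  : ST          -- ST nonempty
    ac₀  : AC          -- AC nonempty
    av   : (A : Subset n) → ST → JA AC A → Set
    out  : (A : Subset n) → ST → JA AC A → ST → Set
    lab  : ST → AP → Set

Countable : Set → Set
Countable X = Σ (X → ℕ) Injective₀
  where Injective₀ : (X → ℕ) → Set
        Injective₀ f = ∀ {x y} → f x ≡ f y → x ≡ y

module _ {n : ℕ} {AP : Set} (M : Model n AP) where
  open Model M

  AG : Subset n
  AG = Full

  Cond1a : Set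
  Cond1a = ∀ (A : Subset n) (s : ST) (σA : JA AC A) →
    av A s σA ⇔ (∃ λ (σ : JA AC AG) → av AG s σ × restrict A σ ≡ σA)

  Cond1b : Set
  Cond1b = ∀ (s : ST) (σ : JA AC AG) → av AG s σ ⇔ (∃ λ (t : ST) → out AG s σ t)

  CondOut : Set
  CondOut = ∀ (A : Subset n) (s : ST) (σA : JA AC A) (t : ST) →
    out A s σA t ⇔ (∃ λ (σ : JA AC AG) → (_⊆J_ {A = A} {B = AG} σA σ) × out AG s σ t)

  Cond2b : Set
  Cond2b = ∀ (A : Subset n) (s : ST) (σA : JA AC A) → av A s σA ⇔ (∃ λ (t : ST) → out A s σA t)

  Conditions1 : Set
  Conditions1 = Cond1a × Cond1b × CondOut

  Conditions2 : Set
  Conditions2 = CondOut × Cond2b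

{-# OPTIONS --safe #-}
module Submission where

-- Both sets of conditions say, given (1c) = (2a), that σ_A is available at s
-- exactly when it extends to a joint action of AG with a nonempty outcome:
-- under (1) through av_AG(s)|_A and (1b), since σ_AG|_A = σ_A iff σ_A ⊆ σ_AG;
-- under (2) through out_A(s, σ_A), a union of such outcomes.

open import Defs
open import Data.Nat using (ℕ; suc)
open import Data.Bool using (true; false)
open import Data.Fin using (zero; suc)
open import Data.Fin.Subset using (Subset) renaming (⊤ to Full)
open import Data.Vec using ([]; _∷_)
open import Data.Product using (_×_; _,_; ∃)
open import Function using (_⇔_; mk⇔; Equivalence)
open import Function.Properties.Equivalence using (⇔-setoid)
open import Level using (0ℓ)
open import Relation.Binary.PropositionalEquality using (_≡_; refl; cong₂)
open import Relation.Binary.Reasoning.Setoid (⇔-setoid 0ℓ)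

module _ {AC : Set} where

  _⊇[_]_ : ∀ {n} → JA AC (Full {n}) → (A : Subset n) → JA AC A → Set
  σ ⊇[ A ] σA = _⊆J_ {A = A} {B = Full} σA σ

  ⊇-restrict : ∀ {n} (A : Subset n) (σ : JA AC (Full {n})) → σ ⊇[ A ] restrict A σ
  ⊇-restrict (true ∷ A)  (a , σ) zero    b a≡b = a≡b
  ⊇-restrict (true ∷ A)  (a , σ) (suc i) b σ↦b = ⊇-restrict A σ i b σ↦b
  ⊇-restrict (false ∷ A) (a , σ) (suc i) b σ↦b = ⊇-restrict A σ i b σ↦b

  ⊇⇒restrict≡ : ∀ {n} (A : Subset n) (σ : JA AC (Full {n})) (σA : JA AC A) →
                σ ⊇[ A ] σA → restrict A σ ≡ σA
  ⊇⇒restrict≡ []          σ       σA       σ⊇σA = refl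
  ⊇⇒restrict≡ (true ∷ A)  (a , σ) (b , σA) σ⊇σA =
    cong₂ _,_ (σ⊇σA zero b refl) (⊇⇒restrict≡ A σ σA (λ i → σ⊇σA (suc i)))
  ⊇⇒restrict≡ (false ∷ A) (a , σ) σA       σ⊇σA =
    ⊇⇒restrict≡ A σ σA (λ i → σ⊇σA (suc i))

  restrict≡⇒⊇ : ∀ {n} (A : Subset n) (σ : JA AC (Full {n})) (σA : JA AC A) →
                restrict A σ ≡ σA → σ ⊇[ A ] σA
  restrict≡⇒⊇ A σ .(restrict A σ) refl = ⊇-restrict A σ

module _ {n : ℕ} {AP : Set} (M : Model n AP) where
  open Model M

  Enabled : (A : Subset n) → ST → JA AC A → Set
  Enabled A s σA = ∃ (out A s σA)

  RestrictedAv : (A : Subset n) → ST → JA AC A → Set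
  RestrictedAv A s σA = ∃ λ σ → av (AG M) s σ × restrict A σ ≡ σA

  ExtendsToEnabled : (A : Subset n) → ST → JA AC A → Set
  ExtendsToEnabled A s σA = ∃ λ σ → σ ⊇[ A ] σA × Enabled (AG M) s σ

  restricted-av⇔extends-to-enabled : Cond1b M → ∀ A s σA →
    RestrictedAv A s σA ⇔ ExtendsToEnabled A s σA
  restricted-av⇔extends-to-enabled cond1b A s σA = mk⇔
    (λ { (σ , avσ , σ|A≡σA) → σ , restrict≡⇒⊇ A σ σA σ|A≡σA , to (cond1b s σ) avσ })
    (λ { (σ , σ⊇σA , enabledσ) → σ , from (cond1b s σ) enabledσ , ⊇⇒restrict≡ A σ σA σ⊇σA })
    where open Equivalence

  enabled⇔extends-to-enabled : CondOut M → ∀ A s σA →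
    Enabled A s σA ⇔ ExtendsToEnabled A s σA
  enabled⇔extends-to-enabled condOut A s σA = mk⇔
    (λ { (t , outt) → let (σ , σ⊇σA , outσt) = to (condOut A s σA t) outt in σ , σ⊇σA , t , outσt })
    (λ { (σ , σ⊇σA , t , outσt) → t , from (condOut A s σA t) (σ , σ⊇σA , outσt) })
    where open Equivalence

mainTheorem9 : (m : ℕ) (AP : Set) → Countable AP → (M : Model (suc m) AP) →
    Conditions1 M ⇔ Conditions2 M
mainTheorem9 _ _ _ M = mk⇔ 1⇒2 2⇒1
  where
  open Model M

  1⇒2 : Conditions1 M → Conditions2 M
  1⇒2 (cond1a , cond1b , condOut) = condOut , λ A s σA → begin
    av A s σA                                       ≈⟨ cond1a A s σA ⟩
    RestrictedAv M A s σA                           ≈⟨ restricted-av⇔extends-to-enabled M cond1b A s σA ⟩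
    ExtendsToEnabled M A s σA                       ≈⟨ enabled⇔extends-to-enabled M condOut A s σA ⟨
    Enabled M A s σA                                ∎

  2⇒1 : Conditions2 M → Conditions1 M
  2⇒1 (condOut , cond2b) = cond1a , cond2b Full , condOut
    where
    cond1a : Cond1a M
    cond1a A s σA = begin
      av A s σA                                     ≈⟨ cond2b A s σA ⟩
      Enabled M A s σA                              ≈⟨ enabled⇔extends-to-enabled M condOut A s σA ⟩
      ExtendsToEnabled M A s σA                     ≈⟨ restricted-av⇔extends-to-enabled M (cond2b Full) A s σA ⟨
      RestrictedAv M A s σA                         ∎
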